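{- Let $P=[a_1]\times[a_2]\times[a_3]$ and $I\in J(P)$. Then $\mathrm{Pro}_{(-1,1,-1)}(\Delta^1_{(1,1,-1)}I)=\Delta^1_{(1,1,-1)}(\mathrm{Pro}_{(1,1,-1)}(I))$.
   Context: $[m]=\{1,\dots,m\}$; $P$ has the componentwise order, elements viewed as vectors in $\mathbb{Z}^3$; $J(P)$ is the set of order ideals. The toggle $t_e(I)$ is $I\cup\{e\}$ if $e\notin I$ and this is an order ideal, $I\setminus\{e\}$ if $e\in I$ and this is an order ideal, and $I$ otherwise. For $w\in\{\pm1\}^3$, $T^i_w$ is the (commuting) product of toggles $t_x$ over $x\in P$ with $\langle x,w\rangle=i$, and $\mathrm{Pro}_w=\cdots T^{ -1}_wT^0_wT^1_w\cdots$ applies the $T^i_w$ in decreasing order of $i$. For $I\in J(P)$, $L^j_\gamma(I)=\{x\in I:x_\gamma=j\}$ and $\Delta^\gamma_v I=\bigcup_{j=1}^{a_\gamma}L^j_\gamma(\mathrm{Pro}_v^{j-1}(I))$. -}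

module Defs where

open import Data.Bool using (Bool; true; false; _∧_; _∨_; not; if_then_else_)
open import Data.Nat as ℕ using (ℕ; suc)
open import Data.Fin using (Fin; toℕ)
open import Data.Fin.Properties using () renaming (_≟_ to _≟ᶠ_)
open import Data.Integer as ℤ using (ℤ; +_)
open import Data.List using (List; []; _∷_; map; concatMap; foldr; foldl; upTo; allFin)
open import Data.Bool.ListAction using (all; any)
open import Data.Product using (_×_; _,_)
open import Relation.Nullary.Decidable using (⌊_⌋)
open import Function using (_∘_)

-- Elements of P = [a₁]×[a₂]×[a₃]; coordinate value = toℕ i + 1.
Elt : ℕ → ℕ → ℕ → Set
Elt a₁ a₂ a₃ = Fin a₁ × Fin a₂ × Fin a₃

SubP : ℕ → ℕ → ℕ → Set
SubP a₁ a₂ a₃ = Elt a₁ a₂ a₃ → Bool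

module _ {a₁ a₂ a₃ : ℕ} where

  elems : List (Elt a₁ a₂ a₃)
  elems = concatMap (λ i → concatMap (λ j → map (λ k → i , j , k) (allFin a₃)) (allFin a₂)) (allFin a₁)

  _≤P_ : Elt a₁ a₂ a₃ → Elt a₁ a₂ a₃ → Set
  (i , j , k) ≤P (i' , j' , k') = (toℕ i ℕ.≤ toℕ i') × (toℕ j ℕ.≤ toℕ j') × (toℕ k ℕ.≤ toℕ k')

  _≤ᵇ_ : Elt a₁ a₂ a₃ → Elt a₁ a₂ a₃ → Bool
  (i , j , k) ≤ᵇ (i' , j' , k') = ⌊ toℕ i ℕ.≤? toℕ i' ⌋ ∧ ⌊ toℕ j ℕ.≤? toℕ j' ⌋ ∧ ⌊ toℕ k ℕ.≤? toℕ k' ⌋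

  _≟ᴱ_ : Elt a₁ a₂ a₃ → Elt a₁ a₂ a₃ → Bool
  (i , j , k) ≟ᴱ (i' , j' , k') = ⌊ i ≟ᶠ i' ⌋ ∧ ⌊ j ≟ᶠ j' ⌋ ∧ ⌊ k ≟ᶠ k' ⌋

  IsOrderIdeal : SubP a₁ a₂ a₃ → Set
  IsOrderIdeal I = ∀ x y → x ≤P y → I y ≡ true → I x ≡ true
    where open import Relation.Binary.PropositionalEquality using (_≡_)

  isIdealᵇ : SubP a₁ a₂ a₃ → Bool
  isIdealᵇ S = all (λ y → all (λ x → not (S y) ∨ not (x ≤ᵇ y) ∨ S x) elems) elems

  insert remove : Elt a₁ a₂ a₃ → SubP a₁ a₂ a₃ → SubP a₁ a₂ a₃
  insert e I x = (x ≟ᴱ e) ∨ I x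
  remove e I x = not (x ≟ᴱ e) ∧ I x

  toggle : Elt a₁ a₂ a₃ → SubP a₁ a₂ a₃ → SubP a₁ a₂ a₃
  toggle e I = if I e
               then (if isIdealᵇ (remove e I) then remove e I else I)
               else (if isIdealᵇ (insert e I) then insert e I else I)

  coord₁ coord₂ coord₃ : Elt a₁ a₂ a₃ → ℤ
  coord₁ (i , _ , _) = + suc (toℕ i)
  coord₂ (_ , j , _) = + suc (toℕ j)
  coord₃ (_ , _ , k) = + suc (toℕ k)

  ⟨_,_⟩ : Elt a₁ a₂ a₃ → ℤ × ℤ × ℤ → ℤ
  ⟨ x , (w₁ , w₂ , w₃) ⟩ = coord₁ x ℤ.* w₁ ℤ.+ coord₂ x ℤ.* w₂ ℤ.+ coord₃ x ℤ.* w₃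

  -- T^i_w : product of toggles t_x over x with ⟨x,w⟩ = i (they commute;
  -- applied in the order of the enumeration 'elems')
  T : ℤ → ℤ × ℤ × ℤ → SubP a₁ a₂ a₃ → SubP a₁ a₂ a₃
  T i w I = foldr (λ x J → if ⌊ ⟨ x , w ⟩ ℤ.≟ i ⌋ then toggle x J else J) I elems

  -- all possible values of ⟨x,w⟩ lie in [-N, N], N = a₁+a₂+a₃; listed decreasingly
  ranks : List ℤ
  ranks = map (λ k → + (a₁ ℕ.+ a₂ ℕ.+ a₃) ℤ.- + k) (upTo (suc (2 ℕ.* (a₁ ℕ.+ a₂ ℕ.+ a₃))))

  Pro : ℤ × ℤ × ℤ → SubP a₁ a₂ a₃ → SubP a₁ a₂ a₃
  Pro w I = foldl (λ J i → T i w J) I ranks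

  iter : ℕ → (SubP a₁ a₂ a₃ → SubP a₁ a₂ a₃) → SubP a₁ a₂ a₃ → SubP a₁ a₂ a₃
  iter ℕ.zero f I = I
  iter (suc n) f I = f (iter n f I)

  -- L^j_1(I) = {x ∈ I : x₁ = j}, level j given as j' : Fin a₁ with j = toℕ j' + 1
  L₁ : Fin a₁ → SubP a₁ a₂ a₃ → SubP a₁ a₂ a₃
  L₁ j I x = ⌊ coord₁ x ℤ.≟ + suc (toℕ j) ⌋ ∧ I x

  Δ₁ : ℤ × ℤ × ℤ → SubP a₁ a₂ a₃ → SubP a₁ a₂ a₃
  Δ₁ v I x = any (λ j → L₁ j (iter (toℕ j) (Pro v) I) x) (allFin a₁)

module Submission where

-- For a sign vector w, covering pairs of P differ in rank ⟨ x , w ⟩ by ±1, so the toggles forming T^i_w act on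
-- pairwise non-adjacent elements and do not interfere. Hence (Pro_w S)(x) is x toggled in an order ideal that
-- agrees with Pro_w S on the neighbours of x of higher rank and with S on those of lower rank, and the outcome
-- depends only on x and these neighbours.
-- Let v = (1, v₂, v₃), u = (-1, v₂, v₃), J ℓ = Pro_v^ℓ I and Δ = Δ^1_v I, whose layer ℓ (first coordinate ℓ + 1)
-- is that of J ℓ. For x in layer ℓ we show (Pro_u Δ)(x) = J (ℓ + 1) (x) = (Pro_v (J ℓ))(x) by downward induction
-- on the u-rank of x, comparing the two toggles of x. Within a layer u and v rank the neighbours alike, and both
-- toggles see J (ℓ + 1) above x and J ℓ below it. Across layers the ranks are reversed, but both toggles still see
-- J (ℓ + 1) on layer ℓ + 1 (through Δ, resp. Pro_v (J ℓ)) and J ℓ on layer ℓ - 1 (through the induction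
-- hypothesis, resp. J ℓ).

open import Defs
open import Data.Bool using (Bool; true; false; _∧_; _∨_; not; if_then_else_)
open import Data.Empty using (⊥-elim)
open import Data.Fin using (Fin; toℕ; fromℕ<)
open import Data.Fin.Properties using (toℕ-injective; toℕ<n; toℕ-fromℕ<) renaming (_≟_ to _≟ᶠ_)
open import Data.List using (List; []; _∷_; map; concatMap; foldr; foldl; allFin)
open import Data.Bool.ListAction using (all; any)
open import Data.List.Membership.Propositional using (_∈_; _∉_; find; lose)
open import Data.List.Membership.Propositional.Properties
  using (∈-concatMap⁺; ∈-concatMap⁻; ∈-map⁺; ∈-map⁻; ∈-allFin; ∈-upTo⁺)
open import Data.List.Relation.Unary.All as All using (All; []; _∷_)
open import Data.List.Relation.Unary.Any as Any using (Any; here; there)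
open import Data.List.Relation.Unary.AllPairs using (AllPairs; []; _∷_)
import Data.List.Relation.Unary.AllPairs.Properties as AllPairs
open import Data.List.Relation.Unary.Unique.Propositional using (Unique)
import Data.List.Relation.Unary.Unique.Propositional.Properties as Unique
open import Data.Nat as ℕ using (ℕ; zero; suc; _∸_)
open import Data.Integer as ℤ using (ℤ; +_; -[1+_])
import Data.Integer.Properties as ℤ
open import Data.Integer.Tactic.RingSolver using (solve-∀)
open import Data.Nat.Tactic.RingSolver using () renaming (solve-∀ to ℕ-solve-∀)
import Data.Nat.Properties as ℕ
import Data.Nat.Induction as ℕ using (<-wellFounded)
open import Induction.WellFounded using (Acc; acc)
open import Data.Product using (_×_; _,_; proj₁; proj₂; Σ-syntax; ∃)
open import Data.Sum using (_⊎_; inj₁; inj₂; [_,_]′)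
open import Function using (_∘_; id; _⇔_; mk⇔; Equivalence)
open import Relation.Nullary using (¬_; Dec; yes; no; _because_; contradiction)
open import Relation.Nullary.Decidable using (⌊_⌋)
open import Relation.Nullary.Reflects using (Reflects; ofʸ; ofⁿ; _×-reflects_; _⊎-reflects_; _→-reflects_; det)
open import Relation.Binary.Definitions using (DecidableEquality; Tri; tri<; tri≈; tri>)
open import Relation.Binary.PropositionalEquality
  using (_≡_; _≢_; refl; sym; trans; cong; cong₂; subst; module ≡-Reasoning)

map-reflects : ∀ {a b} {A : Set a} {B : Set b} {r} → (A → B) → (B → A) → Reflects A r → Reflects B r
map-reflects f g (ofʸ a)  = ofʸ (f a)
map-reflects f g (ofⁿ ¬a) = ofⁿ (¬a ∘ g)

⌊⌋-reflects : ∀ {a} {A : Set a} (a? : Dec A) → Reflects A ⌊ a? ⌋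
⌊⌋-reflects (yes a) = ofʸ a
⌊⌋-reflects (no ¬a) = ofⁿ ¬a

≡true-reflects : ∀ b → Reflects (b ≡ true) b
≡true-reflects true  = ofʸ refl
≡true-reflects false = ofⁿ λ ()

all-reflects : ∀ {a p} {A : Set a} {P : A → Set p} {f : A → Bool} →
               (∀ x → Reflects (P x) (f x)) → ∀ xs → Reflects (All P xs) (all f xs)
all-reflects r []       = ofʸ []
all-reflects r (x ∷ xs) = map-reflects (λ (px , pxs) → px ∷ pxs) All.uncons (r x ×-reflects all-reflects r xs)

any-reflects : ∀ {a p} {A : Set a} {P : A → Set p} {f : A → Bool} →
               (∀ x → Reflects (P x) (f x)) → ∀ xs → Reflects (Any P xs) (any f xs)
any-reflects r []       = ofⁿ λ ()
any-reflects r (x ∷ xs) =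
  map-reflects [ here , there ]′ (λ { (here px) → inj₁ px ; (there pxs) → inj₂ pxs }) (r x ⊎-reflects any-reflects r xs)

any-≡-unique : ∀ {a} {A : Set a} (p : A → Bool) {x xs} → x ∈ xs →
               (∀ {y} → y ∈ xs → p y ≡ true → y ≡ x) → any p xs ≡ p x
any-≡-unique p {x} x∈xs unique = det
  (map-reflects (λ px-any → let y , y∈xs , py = find px-any in subst (λ z → p z ≡ true) (unique y∈xs py) py)
                (lose x∈xs)
                (any-reflects (≡true-reflects ∘ p) _))
  (≡true-reflects (p x))

Unique-concatMap⁺ : ∀ {a b} {A : Set a} {B : Set b} (f : A → List B) (π : B → A) {xs : List A} →
                    Unique xs → (∀ x → Unique (f x)) → (∀ x {y} → y ∈ f x → π y ≡ x) →
                    Unique (concatMap f xs)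
Unique-concatMap⁺ f π [] _ _ = []
Unique-concatMap⁺ f π {x ∷ xs} (x∉xs ∷ xs!) fx! π-f =
  Unique.++⁺ (fx! x) (Unique-concatMap⁺ f π xs! fx! π-f) disjoint
  where
  disjoint : ∀ {y} → ¬ (y ∈ f x × y ∈ concatMap f xs)
  disjoint (y∈fx , y∈rest) with find (∈-concatMap⁻ f {xs = xs} y∈rest)
  ... | x′ , x′∈xs , y∈fx′ = All.lookup x∉xs x′∈xs (trans (sym (π-f x y∈fx)) (π-f x′ y∈fx′))

<⇒suc-between : ∀ {n} {i i′ : Fin n} → toℕ i ℕ.< toℕ i′ →
                Σ[ f ∈ Fin n ] toℕ f ≡ suc (toℕ i) × toℕ f ℕ.≤ toℕ i′
<⇒suc-between {i′ = i′} i<i′ =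
  fromℕ< (ℕ.≤-<-trans i<i′ (toℕ<n i′)) , toℕ-fromℕ< _ , subst (ℕ._≤ toℕ i′) (sym (toℕ-fromℕ< _)) i<i′

<⇒pred-between : ∀ {n} {i i′ : Fin n} → toℕ i ℕ.< toℕ i′ →
                 Σ[ f ∈ Fin n ] toℕ i′ ≡ suc (toℕ f) × toℕ i ℕ.≤ toℕ f
<⇒pred-between {i = i} {i′} i<i′ with toℕ i′ | toℕ<n i′
... | suc m | i′<n =
  fromℕ< (ℕ.<⇒≤ i′<n) , cong suc (sym (toℕ-fromℕ< _)) ,
  subst (toℕ i ℕ.≤_) (sym (toℕ-fromℕ< _)) (ℕ.≤-pred i<i′)

module _ {a₁ a₂ a₃ : ℕ} where
  private
    E   = Elt a₁ a₂ a₃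
    Sub = SubP a₁ a₂ a₃

  ∈-elems : (x : E) → x ∈ elems
  ∈-elems (i , j , k) =
    ∈-concatMap⁺ _ (Any.map (λ { refl →
      ∈-concatMap⁺ _ (Any.map (λ { refl → ∈-map⁺ _ (∈-allFin k) }) (∈-allFin j)) }) (∈-allFin i))

  elems-unique : Unique (elems {a₁} {a₂} {a₃})
  elems-unique = Unique-concatMap⁺ _ proj₁ (Unique.allFin⁺ a₁) layer-unique layer-proj₁
    where
    row : Fin a₁ → Fin a₂ → List E
    row i j = map (λ k → i , j , k) (allFin a₃)

    layer-unique : ∀ i → Unique (concatMap (row i) (allFin a₂))
    layer-unique i = Unique-concatMap⁺ (row i) (proj₁ ∘ proj₂) (Unique.allFin⁺ a₂)
      (λ j → Unique.map⁺ (λ { refl → refl }) (Unique.allFin⁺ a₃))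
      (λ j y∈row → case-row (∈-map⁻ _ y∈row))
      where
      case-row : ∀ {j y} → ∃ (λ k → k ∈ allFin a₃ × y ≡ (i , j , k)) → proj₁ (proj₂ y) ≡ j
      case-row (_ , _ , refl) = refl

    layer-proj₁ : ∀ i {y} → y ∈ concatMap (row i) (allFin a₂) → proj₁ y ≡ i
    layer-proj₁ i y∈layer with find (∈-concatMap⁻ (row i) {xs = allFin a₂} y∈layer)
    ... | j , _ , y∈row with ∈-map⁻ _ y∈row
    ... | _ , _ , refl = refl

  ≟ᴱ-reflects : (x y : E) → Reflects (x ≡ y) (x ≟ᴱ y)
  ≟ᴱ-reflects (i , j , k) (i′ , j′ , k′) =
    map-reflects (λ { (refl , refl , refl) → refl }) (λ { refl → refl , refl , refl })
      (⌊⌋-reflects (i ≟ᶠ i′) ×-reflects ⌊⌋-reflects (j ≟ᶠ j′) ×-reflects ⌊⌋-reflects (k ≟ᶠ k′))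

  _≟_ : DecidableEquality E
  x ≟ y = (x ≟ᴱ y) because ≟ᴱ-reflects x y

  ≟ᴱ-refl : (x : E) → (x ≟ᴱ x) ≡ true
  ≟ᴱ-refl x = det (≟ᴱ-reflects x x) (ofʸ refl)

  ≟ᴱ-≢ : {x y : E} → x ≢ y → (x ≟ᴱ y) ≡ false
  ≟ᴱ-≢ {x} {y} x≢y = det (≟ᴱ-reflects x y) (ofⁿ x≢y)

  ≤ᵇ-reflects : (x y : E) → Reflects (x ≤P y) (x ≤ᵇ y)
  ≤ᵇ-reflects (i , j , k) (i′ , j′ , k′) =
    ⌊⌋-reflects (toℕ i ℕ.≤? toℕ i′) ×-reflects ⌊⌋-reflects (toℕ j ℕ.≤? toℕ j′) ×-reflects ⌊⌋-reflects (toℕ k ℕ.≤? toℕ k′)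

  isIdealᵇ-reflects : (S : Sub) → Reflects (IsOrderIdeal S) (isIdealᵇ S)
  isIdealᵇ-reflects S =
    map-reflects (λ h x y x≤y Sy → All.lookup (All.lookup h (∈-elems y)) (∈-elems x) Sy x≤y)
                 (λ ideal → All.tabulate λ {y} _ → All.tabulate λ {x} _ Sy x≤y → ideal x y x≤y Sy)
      (all-reflects (λ y → all-reflects (λ x →
        ≡true-reflects (S y) →-reflects ≤ᵇ-reflects x y →-reflects ≡true-reflects (S x)) elems) elems)

  -- Covers and toggles

  infix 4 _⋖_
  data _⋖_ : E → E → Set where
    ⋖₁ : ∀ {i i′ j k} → toℕ i′ ≡ suc (toℕ i) → (i , j , k) ⋖ (i′ , j , k)
    ⋖₂ : ∀ {i j j′ k} → toℕ j′ ≡ suc (toℕ j) → (i , j , k) ⋖ (i , j′ , k)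
    ⋖₃ : ∀ {i j k k′} → toℕ k′ ≡ suc (toℕ k) → (i , j , k) ⋖ (i , j , k′)

  Adjacent : E → E → Set
  Adjacent x y = x ⋖ y ⊎ y ⋖ x

  ⋖⇒≤P : ∀ {x y} → x ⋖ y → x ≤P y
  ⋖⇒≤P (⋖₁ e) = ℕ.<⇒≤ (ℕ.≤-reflexive (sym e)) , ℕ.≤-refl , ℕ.≤-refl
  ⋖⇒≤P (⋖₂ e) = ℕ.≤-refl , ℕ.<⇒≤ (ℕ.≤-reflexive (sym e)) , ℕ.≤-refl
  ⋖⇒≤P (⋖₃ e) = ℕ.≤-refl , ℕ.≤-refl , ℕ.<⇒≤ (ℕ.≤-reflexive (sym e))

  ⋖⇒≢ : ∀ {x y} → x ⋖ y → x ≢ y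
  ⋖⇒≢ (⋖₁ e) refl = ℕ.1+n≢n (sym e)
  ⋖⇒≢ (⋖₂ e) refl = ℕ.1+n≢n (sym e)
  ⋖⇒≢ (⋖₃ e) refl = ℕ.1+n≢n (sym e)

  <P⇒⋖≤P : ∀ {x y : E} → x ≤P y → x ≢ y → Σ[ z ∈ E ] x ⋖ z × z ≤P y
  <P⇒⋖≤P {i , j , k} {i′ , j′ , k′} (p , q , r) x≢y
    with ℕ.m≤n⇒m<n∨m≡n p | ℕ.m≤n⇒m<n∨m≡n q | ℕ.m≤n⇒m<n∨m≡n r
  ... | inj₁ i<i′ | _ | _ =
    let f , f≡ , f≤ = <⇒suc-between i<i′ in (f , j , k) , ⋖₁ f≡ , f≤ , q , r
  ... | inj₂ _ | inj₁ j<j′ | _ =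
    let f , f≡ , f≤ = <⇒suc-between j<j′ in (i , f , k) , ⋖₂ f≡ , p , f≤ , r
  ... | inj₂ _ | inj₂ _ | inj₁ k<k′ =
    let f , f≡ , f≤ = <⇒suc-between k<k′ in (i , j , f) , ⋖₃ f≡ , p , q , f≤
  ... | inj₂ i≡ | inj₂ j≡ | inj₂ k≡ =
    ⊥-elim (x≢y (cong₂ _,_ (toℕ-injective i≡) (cong₂ _,_ (toℕ-injective j≡) (toℕ-injective k≡))))

  <P⇒≤P⋖ : ∀ {x y : E} → x ≤P y → x ≢ y → Σ[ z ∈ E ] x ≤P z × z ⋖ y
  <P⇒≤P⋖ {i , j , k} {i′ , j′ , k′} (p , q , r) x≢y
    with ℕ.m≤n⇒m<n∨m≡n p | ℕ.m≤n⇒m<n∨m≡n q | ℕ.m≤n⇒m<n∨m≡n r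
  ... | inj₁ i<i′ | _ | _ =
    let f , f≡ , f≥ = <⇒pred-between i<i′ in (f , j′ , k′) , (f≥ , q , r) , ⋖₁ f≡
  ... | inj₂ _ | inj₁ j<j′ | _ =
    let f , f≡ , f≥ = <⇒pred-between j<j′ in (i′ , f , k′) , (p , f≥ , r) , ⋖₂ f≡
  ... | inj₂ _ | inj₂ _ | inj₁ k<k′ =
    let f , f≡ , f≥ = <⇒pred-between k<k′ in (i′ , j′ , f) , (p , q , f≥) , ⋖₃ f≡
  ... | inj₂ i≡ | inj₂ j≡ | inj₂ k≡ =
    ⊥-elim (x≢y (cong₂ _,_ (toℕ-injective i≡) (cong₂ _,_ (toℕ-injective j≡) (toℕ-injective k≡))))

  insert-self : ∀ e (M : Sub) → insert e M e ≡ true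
  insert-self e M = cong (_∨ M e) (≟ᴱ-refl e)

  insert-other : ∀ {e y} (M : Sub) → y ≢ e → insert e M y ≡ M y
  insert-other M y≢e = cong (_∨ M _) (≟ᴱ-≢ y≢e)

  remove-self : ∀ e (M : Sub) → remove e M e ≡ false
  remove-self e M = cong (λ b → not b ∧ M e) (≟ᴱ-refl e)

  remove-other : ∀ {e y} (M : Sub) → y ≢ e → remove e M y ≡ M y
  remove-other M y≢e = cong (λ b → not b ∧ M _) (≟ᴱ-≢ y≢e)

  Removable Addable : Sub → E → Set
  Removable M e = ∀ y → e ⋖ y → M y ≡ false
  Addable   M e = ∀ y → y ⋖ e → M y ≡ true

  remove-isOrderIdeal⇔ : ∀ {e} {M : Sub} → IsOrderIdeal M → IsOrderIdeal (remove e M) ⇔ Removable M e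
  remove-isOrderIdeal⇔ {e} {M} ideal = mk⇔ removable ideal′
    where
    removable : IsOrderIdeal (remove e M) → Removable M e
    removable ideal-e y e⋖y with M y in My
    ... | false = refl
    ... | true  = contradiction (trans (sym (remove-self e M)) (ideal-e e y (⋖⇒≤P e⋖y) y∈)) λ ()
      where y∈ = trans (remove-other M (⋖⇒≢ e⋖y ∘ sym)) My

    ideal′ : Removable M e → IsOrderIdeal (remove e M)
    ideal′ free x y x≤y y∈ with y ≟ e | x ≟ e
    ... | yes refl | _      = contradiction (trans (sym (remove-self e M)) y∈) λ ()
    ... | no y≢e   | no x≢e = trans (remove-other M x≢e) (ideal x y x≤y My)
      where My = trans (sym (remove-other M y≢e)) y∈
    ... | no y≢e   | yes refl with <P⇒⋖≤P x≤y (y≢e ∘ sym)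
    ...   | z , x⋖z , z≤y = contradiction (trans (sym (free z x⋖z)) (ideal z y z≤y My)) λ ()
      where My = trans (sym (remove-other M y≢e)) y∈

  insert-isOrderIdeal⇔ : ∀ {e} {M : Sub} → IsOrderIdeal M → IsOrderIdeal (insert e M) ⇔ Addable M e
  insert-isOrderIdeal⇔ {e} {M} ideal = mk⇔ addable ideal′
    where
    addable : IsOrderIdeal (insert e M) → Addable M e
    addable ideal-e y y⋖e =
      trans (sym (insert-other M (⋖⇒≢ y⋖e))) (ideal-e y e (⋖⇒≤P y⋖e) (insert-self e M))

    ideal′ : Addable M e → IsOrderIdeal (insert e M)
    ideal′ full x y x≤y y∈ with x ≟ e | y ≟ e
    ... | yes refl | _        = insert-self e M
    ... | no x≢e   | no y≢e   = trans (insert-other M x≢e) (ideal x y x≤y (trans (sym (insert-other M y≢e)) y∈))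
    ... | no x≢e   | yes refl with <P⇒≤P⋖ x≤y x≢e
    ...   | z , x≤z , z⋖e = trans (insert-other M x≢e) (ideal x z x≤z (full z z⋖e))

  toggle-other : ∀ {e y} (M : Sub) → y ≢ e → toggle e M y ≡ M y
  toggle-other {e} M y≢e with M e | isIdealᵇ (remove e M) | isIdealᵇ (insert e M)
  ... | true  | true  | _     = remove-other M y≢e
  ... | true  | false | _     = refl
  ... | false | _     | true  = insert-other M y≢e
  ... | false | _     | false = refl

  toggle-isOrderIdeal : ∀ e {M : Sub} → IsOrderIdeal M → IsOrderIdeal (toggle e M)
  toggle-isOrderIdeal e {M} ideal with M e | isIdealᵇ (remove e M) | isIdealᵇ-reflects (remove e M)
                                         | isIdealᵇ (insert e M) | isIdealᵇ-reflects (insert e M)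
  ... | true  | true  | ofʸ ideal-e | _     | _           = ideal-e
  ... | true  | false | _           | _     | _           = ideal
  ... | false | _     | _           | true  | ofʸ ideal-e = ideal-e
  ... | false | _     | _           | false | _           = ideal

  toggle-self : ∀ e (M : Sub) →
                toggle e M e ≡ (if M e then not (isIdealᵇ (remove e M)) else isIdealᵇ (insert e M))
  toggle-self e M with M e in Me | isIdealᵇ (remove e M) | isIdealᵇ (insert e M)
  ... | true  | true  | _     = remove-self e M
  ... | true  | false | _     = Me
  ... | false | _     | true  = insert-self e M
  ... | false | _     | false = Me

  removable-reflects : ∀ {e} {M : Sub} → IsOrderIdeal M → Reflects (Removable M e) (isIdealᵇ (remove e M))
  removable-reflects ideal = map-reflects to from (isIdealᵇ-reflects _)
    where open Equivalence (remove-isOrderIdeal⇔ ideal)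

  addable-reflects : ∀ {e} {M : Sub} → IsOrderIdeal M → Reflects (Addable M e) (isIdealᵇ (insert e M))
  addable-reflects ideal = map-reflects to from (isIdealᵇ-reflects _)
    where open Equivalence (insert-isOrderIdeal⇔ ideal)

  toggle-local : ∀ {e} {M₁ M₂ : Sub} → IsOrderIdeal M₁ → IsOrderIdeal M₂ → M₁ e ≡ M₂ e →
                 (∀ y → Adjacent e y → M₁ y ≡ M₂ y) → toggle e M₁ e ≡ toggle e M₂ e
  toggle-local {e} {M₁} {M₂} ideal₁ ideal₂ M₁e≡M₂e agree = begin
    toggle e M₁ e                           ≡⟨ toggle-self e M₁ ⟩
    outcome (M₁ e) removable₁ addable₁      ≡⟨ cong₂ (outcome (M₁ e)) removable-agrees addable-agrees ⟩
    outcome (M₁ e) removable₂ addable₂      ≡⟨ cong (λ b → outcome b removable₂ addable₂) M₁e≡M₂e ⟩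
    outcome (M₂ e) removable₂ addable₂      ≡⟨ toggle-self e M₂ ⟨
    toggle e M₂ e                           ∎
    where
    open ≡-Reasoning
    outcome : Bool → Bool → Bool → Bool
    outcome b r a = if b then not r else a
    removable₁ = isIdealᵇ (remove e M₁)
    removable₂ = isIdealᵇ (remove e M₂)
    addable₁   = isIdealᵇ (insert e M₁)
    addable₂   = isIdealᵇ (insert e M₂)

    removable-agrees : removable₁ ≡ removable₂
    removable-agrees = det (removable-reflects ideal₁)
      (map-reflects (λ free₂ y e⋖y → trans (agree y (inj₁ e⋖y)) (free₂ y e⋖y))
                    (λ free₁ y e⋖y → trans (sym (agree y (inj₁ e⋖y))) (free₁ y e⋖y))
                    (removable-reflects ideal₂))

    addable-agrees : addable₁ ≡ addable₂
    addable-agrees = det (addable-reflects ideal₁)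
      (map-reflects (λ full₂ y y⋖e → trans (agree y (inj₂ y⋖e)) (full₂ y y⋖e))
                    (λ full₁ y y⋖e → trans (sym (agree y (inj₂ y⋖e))) (full₁ y y⋖e))
                    (addable-reflects ideal₂))

-- Ranks for sign vectors

data Sign : ℤ → Set where
  +1ˢ : Sign (+ 1)
  -1ˢ : Sign -[1+ 0 ]

SignVector : ℤ × ℤ × ℤ → Set
SignVector (w₁ , w₂ , w₃) = Sign w₁ × Sign w₂ × Sign w₃

i<i+1 : ∀ i → i ℤ.< i ℤ.+ + 1
i<i+1 i = subst (ℤ._< i ℤ.+ + 1) (ℤ.+-identityʳ i) (ℤ.+-monoʳ-< i (ℤ.+<+ ℕ.≤-refl))

i-1<i : ∀ i → i ℤ.+ -[1+ 0 ] ℤ.< i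
i-1<i i = subst (i ℤ.+ -[1+ 0 ] ℤ.<_) (ℤ.+-identityʳ i) (ℤ.+-monoʳ-< i ℤ.-<+)

Sign⇒<⊎> : ∀ {s} → Sign s → ∀ i → i ℤ.< i ℤ.+ s ⊎ i ℤ.+ s ℤ.< i
Sign⇒<⊎> +1ˢ i = inj₁ (i<i+1 i)
Sign⇒<⊎> -1ˢ i = inj₂ (i-1<i i)

-- The d ≥ 0 with a - d = (toℕ c + 1) s. Summed over the coordinates this writes ⟨ x , w ⟩ = N - depth x
-- with depth x ≤ 2 N, which places every rank in 'ranks' and gives a measure for induction on ranks.
offset : ∀ {a s} → Sign s → Fin a → ℕ
offset {a} +1ˢ c = a ∸ suc (toℕ c)
offset {a} -1ˢ c = a ℕ.+ suc (toℕ c)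

offset-≤ : ∀ {a s} (σ : Sign s) (c : Fin a) → offset σ c ℕ.≤ a ℕ.+ a
offset-≤ {a} +1ˢ c = ℕ.≤-trans (ℕ.m∸n≤m a (suc (toℕ c))) (ℕ.m≤m+n a a)
offset-≤ {a} -1ˢ c = ℕ.+-monoʳ-≤ a (toℕ<n c)

offset-spec : ∀ {a s} (σ : Sign s) (c : Fin a) → + a ℤ.- + offset σ c ≡ + suc (toℕ c) ℤ.* s
offset-spec {a} +1ˢ c = begin
  + a ℤ.- + (a ∸ suc (toℕ c))                               ≡⟨ cong (λ n → + n ℤ.- + (a ∸ suc (toℕ c))) (ℕ.m+[n∸m]≡n (toℕ<n c)) ⟨
  + (suc (toℕ c) ℕ.+ (a ∸ suc (toℕ c))) ℤ.- + (a ∸ suc (toℕ c)) ≡⟨ cancel (+ suc (toℕ c)) (+ (a ∸ suc (toℕ c))) ⟩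
  + suc (toℕ c) ℤ.* + 1                                     ∎
  where
  open ≡-Reasoning
  cancel : ∀ m n → (m ℤ.+ n) ℤ.- n ≡ m ℤ.* + 1
  cancel = solve-∀
offset-spec {a} -1ˢ c = cancel (+ a) (+ suc (toℕ c))
  where
  cancel : ∀ m n → m ℤ.- (m ℤ.+ n) ≡ n ℤ.* -[1+ 0 ]
  cancel = solve-∀

module _ {a₁ a₂ a₃ : ℕ} where
  private
    E   = Elt a₁ a₂ a₃
    Sub = SubP a₁ a₂ a₃

  weight : ∀ {x y : E} → x ⋖ y → ℤ × ℤ × ℤ → ℤ
  weight (⋖₁ _) (w₁ , _  , _ ) = w₁
  weight (⋖₂ _) (_  , w₂ , _ ) = w₂
  weight (⋖₃ _) (_  , _  , w₃) = w₃

  ⟨⟩-⋖ : ∀ w {x y : E} (x⋖y : x ⋖ y) → ⟨ y , w ⟩ ≡ ⟨ x , w ⟩ ℤ.+ weight x⋖y w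
  ⟨⟩-⋖ (w₁ , w₂ , w₃) (⋖₁ {i} {j = j} {k} e) rewrite e =
    shift (+ suc (toℕ i)) (+ suc (toℕ j)) (+ suc (toℕ k)) w₁ w₂ w₃
    where
    shift : ∀ a b c w₁ w₂ w₃ →
            (+ 1 ℤ.+ a) ℤ.* w₁ ℤ.+ b ℤ.* w₂ ℤ.+ c ℤ.* w₃ ≡ (a ℤ.* w₁ ℤ.+ b ℤ.* w₂ ℤ.+ c ℤ.* w₃) ℤ.+ w₁
    shift = solve-∀
  ⟨⟩-⋖ (w₁ , w₂ , w₃) (⋖₂ {i} {j} {k = k} e) rewrite e =
    shift (+ suc (toℕ i)) (+ suc (toℕ j)) (+ suc (toℕ k)) w₁ w₂ w₃
    where
    shift : ∀ a b c w₁ w₂ w₃ →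
            a ℤ.* w₁ ℤ.+ (+ 1 ℤ.+ b) ℤ.* w₂ ℤ.+ c ℤ.* w₃ ≡ (a ℤ.* w₁ ℤ.+ b ℤ.* w₂ ℤ.+ c ℤ.* w₃) ℤ.+ w₂
    shift = solve-∀
  ⟨⟩-⋖ (w₁ , w₂ , w₃) (⋖₃ {i} {j} {k} e) rewrite e =
    shift (+ suc (toℕ i)) (+ suc (toℕ j)) (+ suc (toℕ k)) w₁ w₂ w₃
    where
    shift : ∀ a b c w₁ w₂ w₃ →
            a ℤ.* w₁ ℤ.+ b ℤ.* w₂ ℤ.+ (+ 1 ℤ.+ c) ℤ.* w₃ ≡ (a ℤ.* w₁ ℤ.+ b ℤ.* w₂ ℤ.+ c ℤ.* w₃) ℤ.+ w₃
    shift = solve-∀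

  ⟨⟩-⋖-up : ∀ {w} {x y : E} (x⋖y : x ⋖ y) → weight x⋖y w ≡ + 1 → ⟨ x , w ⟩ ℤ.< ⟨ y , w ⟩
  ⟨⟩-⋖-up {w} {x} x⋖y weight≡ rewrite ⟨⟩-⋖ w x⋖y | weight≡ = i<i+1 ⟨ x , w ⟩

  ⟨⟩-⋖-down : ∀ {w} {x y : E} (x⋖y : x ⋖ y) → weight x⋖y w ≡ -[1+ 0 ] → ⟨ y , w ⟩ ℤ.< ⟨ x , w ⟩
  ⟨⟩-⋖-down {w} {x} x⋖y weight≡ rewrite ⟨⟩-⋖ w x⋖y | weight≡ = i-1<i ⟨ x , w ⟩

  weight-sign : ∀ {w} → SignVector w → ∀ {x y : E} (x⋖y : x ⋖ y) → Sign (weight x⋖y w)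
  weight-sign (σ₁ , _  , _ ) (⋖₁ _) = σ₁
  weight-sign (_  , σ₂ , _ ) (⋖₂ _) = σ₂
  weight-sign (_  , _  , σ₃) (⋖₃ _) = σ₃

  ⟨⟩-⋖-<⊎> : ∀ {w} → SignVector w → ∀ {x y : E} → x ⋖ y → ⟨ x , w ⟩ ℤ.< ⟨ y , w ⟩ ⊎ ⟨ y , w ⟩ ℤ.< ⟨ x , w ⟩
  ⟨⟩-⋖-<⊎> {w} σ {x} x⋖y rewrite ⟨⟩-⋖ w x⋖y = Sign⇒<⊎> (weight-sign σ x⋖y) ⟨ x , w ⟩

  ⟨⟩-adjacent-≢ : ∀ {w} → SignVector w → ∀ {x y : E} → Adjacent x y → ⟨ x , w ⟩ ≢ ⟨ y , w ⟩
  ⟨⟩-adjacent-≢ σ (inj₁ x⋖y) with ⟨⟩-⋖-<⊎> σ x⋖y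
  ... | inj₁ x<y = ℤ.<⇒≢ x<y
  ... | inj₂ y<x = ℤ.<⇒≢ y<x ∘ sym
  ⟨⟩-adjacent-≢ σ (inj₂ y⋖x) with ⟨⟩-⋖-<⊎> σ y⋖x
  ... | inj₁ y<x = ℤ.<⇒≢ y<x ∘ sym
  ... | inj₂ x<y = ℤ.<⇒≢ x<y

  depth : ∀ {w} → SignVector w → E → ℕ
  depth (σ₁ , σ₂ , σ₃) (i , j , k) = offset σ₁ i ℕ.+ offset σ₂ j ℕ.+ offset σ₃ k

  ⟨⟩≡N-depth : ∀ {w} (σ : SignVector w) (x : E) → ⟨ x , w ⟩ ≡ + (a₁ ℕ.+ a₂ ℕ.+ a₃) ℤ.- + depth σ x
  ⟨⟩≡N-depth {w} (σ₁ , σ₂ , σ₃) (i , j , k) = begin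
    ⟨ (i , j , k) , w ⟩                                          ≡⟨ cong₂ ℤ._+_ (cong₂ ℤ._+_ (offset-spec σ₁ i) (offset-spec σ₂ j)) (offset-spec σ₃ k) ⟨
    (+ a₁ ℤ.- + d₁) ℤ.+ (+ a₂ ℤ.- + d₂) ℤ.+ (+ a₃ ℤ.- + d₃)        ≡⟨ regroup (+ a₁) (+ a₂) (+ a₃) (+ d₁) (+ d₂) (+ d₃) ⟩
    + (a₁ ℕ.+ a₂ ℕ.+ a₃) ℤ.- + (d₁ ℕ.+ d₂ ℕ.+ d₃)                ∎
    where
    open ≡-Reasoning
    d₁ = offset σ₁ i
    d₂ = offset σ₂ j
    d₃ = offset σ₃ k
    regroup : ∀ m₁ m₂ m₃ n₁ n₂ n₃ → (m₁ ℤ.- n₁) ℤ.+ (m₂ ℤ.- n₂) ℤ.+ (m₃ ℤ.- n₃) ≡ (m₁ ℤ.+ m₂ ℤ.+ m₃) ℤ.- (n₁ ℤ.+ n₂ ℤ.+ n₃)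
    regroup = solve-∀

  depth-≤ : ∀ {w} (σ : SignVector w) (x : E) → depth σ x ℕ.≤ 2 ℕ.* (a₁ ℕ.+ a₂ ℕ.+ a₃)
  depth-≤ (σ₁ , σ₂ , σ₃) (i , j , k) =
    ℕ.≤-trans (ℕ.+-mono-≤ (ℕ.+-mono-≤ (offset-≤ σ₁ i) (offset-≤ σ₂ j)) (offset-≤ σ₃ k))
              (ℕ.≤-reflexive (double a₁ a₂ a₃))
    where
    double : ∀ m n o → m ℕ.+ m ℕ.+ (n ℕ.+ n) ℕ.+ (o ℕ.+ o) ≡ 2 ℕ.* (m ℕ.+ n ℕ.+ o)
    double = ℕ-solve-∀

  ⟨⟩∈ranks : ∀ {w} → SignVector w → (x : E) → ⟨ x , w ⟩ ∈ ranks {a₁} {a₂} {a₃}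
  ⟨⟩∈ranks σ x = subst (_∈ ranks {a₁} {a₂} {a₃}) (sym (⟨⟩≡N-depth σ x)) (∈-map⁺ _ (∈-upTo⁺ (ℕ.s≤s (depth-≤ σ x))))

  ranks-decreasing : AllPairs ℤ._>_ (ranks {a₁} {a₂} {a₃})
  ranks-decreasing = AllPairs.map⁺ (AllPairs.applyUpTo⁺₁ id _ λ i<j _ → ℤ.+-monoʳ-< (+ _) (ℤ.neg-mono-< (ℤ.+<+ i<j)))

  depth-anti : ∀ {w} (σ : SignVector w) {x y : E} → ⟨ x , w ⟩ ℤ.< ⟨ y , w ⟩ → depth σ y ℕ.< depth σ x
  depth-anti {w} σ {x} {y} x<y = ℕ.≰⇒> λ dx≤dy → ℤ.<⇒≱ x<y (begin
    ⟨ y , w ⟩                    ≡⟨ ⟨⟩≡N-depth σ y ⟩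
    + N ℤ.- + depth σ y          ≤⟨ ℤ.+-monoʳ-≤ (+ N) (ℤ.neg-mono-≤ (ℤ.+≤+ dx≤dy)) ⟩
    + N ℤ.- + depth σ x          ≡⟨ ⟨⟩≡N-depth σ x ⟨
    ⟨ x , w ⟩                    ∎)
    where
    open ℤ.≤-Reasoning
    N = a₁ ℕ.+ a₂ ℕ.+ a₃

  -- Promotion as a sweep of rank-wise toggles

  module Promotion (w : ℤ × ℤ × ℤ) (σ : SignVector w) where

    rank : E → ℤ
    rank x = ⟨ x , w ⟩

    record TogglesOfRank (i : ℤ) (S R : Sub) (l : List E) : Set where
      field
        isIdeal   : IsOrderIdeal R
        untouched : ∀ y → (y ∈ l → rank y ≢ i) → R y ≡ S y
        toggled   : ∀ y → y ∈ l → rank y ≡ i → R y ≡ toggle y S y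

    toggles-of-rank : ∀ i {S} → IsOrderIdeal S → ∀ {l} → Unique l →
                      TogglesOfRank i S (foldr (λ x J → if ⌊ rank x ℤ.≟ i ⌋ then toggle x J else J) S l) l
    toggles-of-rank i {S} ideal {[]} [] = record { isIdeal = ideal ; untouched = λ _ _ → refl ; toggled = λ _ () }
    toggles-of-rank i {S} ideal {x ∷ l} (x∉l ∷ l!) with rank x ℤ.≟ i | toggles-of-rank i ideal l!
    ... | no rx≢i | IH = record
      { isIdeal   = TogglesOfRank.isIdeal IH
      ; untouched = λ y y∉ → TogglesOfRank.untouched IH y (y∉ ∘ there)
      ; toggled   = λ { y (here refl) rx≡i → contradiction rx≡i rx≢i
                      ; y (there y∈l)      → TogglesOfRank.toggled IH y y∈l } }
    ... | yes rx≡i | IH = record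
      { isIdeal   = toggle-isOrderIdeal x (TogglesOfRank.isIdeal IH)
      ; untouched = untouched
      ; toggled   = toggled }
      where
      open TogglesOfRank IH renaming (untouched to untouched-l; toggled to toggled-l; isIdeal to ideal-l)
      R = foldr (λ x J → if ⌊ rank x ℤ.≟ i ⌋ then toggle x J else J) S l

      x≢ : ∀ {y} → y ∈ l → y ≢ x
      x≢ y∈l refl = All.lookup x∉l y∈l refl

      untouched : ∀ y → (y ∈ x ∷ l → rank y ≢ i) → toggle x R y ≡ S y
      untouched y y∉ with y ≟ x
      ... | yes refl = contradiction rx≡i (y∉ (here refl))
      ... | no y≢x   = trans (toggle-other R y≢x) (untouched-l y (y∉ ∘ there))

      toggled : ∀ y → y ∈ x ∷ l → rank y ≡ i → toggle x R y ≡ toggle y S y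
      toggled y (here refl) _ = toggle-local ideal-l ideal
        (untouched-l x λ x∈l _ → x≢ x∈l refl)
        (λ z x~z → untouched-l z λ _ rz≡i → ⟨⟩-adjacent-≢ σ x~z (trans rx≡i (sym rz≡i)))
      toggled y (there y∈l) ry≡i = trans (toggle-other R (x≢ y∈l)) (toggled-l y y∈l ry≡i)

    T-isOrderIdeal : ∀ i {S} → IsOrderIdeal S → IsOrderIdeal (T i w S)
    T-isOrderIdeal i ideal = TogglesOfRank.isIdeal (toggles-of-rank i ideal elems-unique)

    T-off : ∀ i {S} → IsOrderIdeal S → ∀ y → rank y ≢ i → T i w S y ≡ S y
    T-off i ideal y ry≢i = TogglesOfRank.untouched (toggles-of-rank i ideal elems-unique) y (λ _ → ry≢i)

    T-on : ∀ i {S} → IsOrderIdeal S → ∀ y → rank y ≡ i → T i w S y ≡ toggle y S y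
    T-on i ideal y = TogglesOfRank.toggled (toggles-of-rank i ideal elems-unique) y (∈-elems y)

    record ToggledFrom (S F : Sub) (x : E) : Set where
      field
        stage       : Sub
        stage-ideal : IsOrderIdeal stage
        stage-at    : stage x ≡ S x
        stage-above : ∀ y → Adjacent x y → rank x ℤ.< rank y → stage y ≡ F y
        stage-below : ∀ y → Adjacent x y → rank y ℤ.< rank x → stage y ≡ S y
        toggled     : F x ≡ toggle x stage x

    record SweptOver (rs : List ℤ) (S F : Sub) : Set where
      field
        isIdeal : IsOrderIdeal F
        unswept : ∀ x → rank x ∉ rs → F x ≡ S x
        swept   : ∀ x → rank x ∈ rs → ToggledFrom S F x

    sweep : ∀ {rs} → AllPairs ℤ._>_ rs → ∀ {S} → IsOrderIdeal S → SweptOver rs S (foldl (λ J i → T i w J) S rs)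
    sweep {[]} [] ideal = record { isIdeal = ideal ; unswept = λ _ _ → refl ; swept = λ _ () }
    sweep {r ∷ rs} (r>rs ∷ rs↓) {S} ideal = record
      { isIdeal = isIdeal
      ; unswept = λ x rx∉ → trans (unswept x (rx∉ ∘ there)) (T-off r ideal x (rx∉ ∘ here))
      ; swept   = swept′ }
      where
      open SweptOver (sweep rs↓ (T-isOrderIdeal r ideal))
      F = foldl (λ J i → T i w J) (T r w S) rs

      ∉rs : ∀ {z} → r ℤ.≤ z → z ∉ rs
      ∉rs r≤z z∈rs = ℤ.<⇒≱ (All.lookup r>rs z∈rs) r≤z

      swept′ : ∀ x → rank x ∈ r ∷ rs → ToggledFrom S F x
      swept′ x (here rx≡r) = record
        { stage = S ; stage-ideal = ideal ; stage-at = refl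
        ; stage-above = λ y _ rx<ry → sym (trans (unswept y (∉rs (subst (ℤ._≤ rank y) rx≡r (ℤ.<⇒≤ rx<ry))))
                                                (T-off r ideal y λ ry≡r → ℤ.<⇒≢ rx<ry (trans rx≡r (sym ry≡r))))
        ; stage-below = λ _ _ _ → refl
        ; toggled = trans (unswept x (∉rs (ℤ.≤-reflexive (sym rx≡r)))) (T-on r ideal x rx≡r) }
      swept′ x (there rx∈rs) = record
        { stage = stage ; stage-ideal = stage-ideal ; stage-above = stage-above ; toggled = toggled
        ; stage-at    = trans stage-at (T-off r ideal x (ℤ.<⇒≢ rx<r))
        ; stage-below = λ y x~y ry<rx → trans (stage-below y x~y ry<rx) (T-off r ideal y (ℤ.<⇒≢ (ℤ.<-trans ry<rx rx<r))) }
        where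
        open ToggledFrom (swept x rx∈rs)
        rx<r = All.lookup r>rs rx∈rs

    Pro-isOrderIdeal : ∀ {S} → IsOrderIdeal S → IsOrderIdeal (Pro w S)
    Pro-isOrderIdeal ideal = SweptOver.isIdeal (sweep ranks-decreasing ideal)

    Pro-toggledFrom : ∀ {S} → IsOrderIdeal S → ∀ x → ToggledFrom S (Pro w S) x
    Pro-toggledFrom ideal x = SweptOver.swept (sweep ranks-decreasing ideal) x (⟨⟩∈ranks σ x)

    Pro-below : ∀ {S} → IsOrderIdeal S → ∀ {x y} → x ⋖ y → rank x ℤ.< rank y → Pro w S y ≡ true → S x ≡ true
    Pro-below {S} ideal {x} {y} x⋖y rx<ry y∈ = begin
      S x                 ≡⟨ stage-below x (inj₂ x⋖y) rx<ry ⟨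
      stage x             ≡⟨ toggle-other stage (⋖⇒≢ x⋖y) ⟨
      toggle y stage x    ≡⟨ toggle-isOrderIdeal y stage-ideal x y (⋖⇒≤P x⋖y) (trans (sym toggled) y∈) ⟩
      true                ∎
      where
      open ≡-Reasoning
      open ToggledFrom (Pro-toggledFrom ideal y)

  iter-suc : ∀ n (f : Sub → Sub) S → iter n f (f S) ≡ iter (suc n) f S
  iter-suc zero    f S = refl
  iter-suc (suc n) f S = cong f (iter-suc n f S)

  iter-+ : ∀ m n (f : Sub → Sub) S → iter (m ℕ.+ n) f S ≡ iter m f (iter n f S)
  iter-+ zero    n f S = refl
  iter-+ (suc m) n f S = cong f (iter-+ m n f S)

  Δ₁-layer : ∀ w (S : Sub) (x : E) → Δ₁ w S x ≡ iter (toℕ (proj₁ x)) (Pro w) S x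
  Δ₁-layer w S x@(i , _ , _) =
    trans (any-≡-unique _ (∈-allFin i) only-layer-i)
          (cong (_∧ iter (toℕ i) (Pro w) S x) (det (⌊⌋-reflects (+ suc (toℕ i) ℤ.≟ + suc (toℕ i))) (ofʸ refl)))
    where
    only-layer-i : ∀ {l} → l ∈ allFin a₁ → L₁ l (iter (toℕ l) (Pro w) S) x ≡ true → l ≡ i
    only-layer-i {l} _ x∈ with + suc (toℕ i) ℤ.≟ + suc (toℕ l)
    ... | yes e = sym (toℕ-injective (ℕ.suc-injective (ℤ.+-injective e)))
    ... | no _  = contradiction x∈ λ ()

-- Promotion commutes with Δ¹

module _ {a₁ a₂ a₃ : ℕ} {v₂ v₃ : ℤ} (σ₂ : Sign v₂) (σ₃ : Sign v₃) where
  private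
    E   = Elt a₁ a₂ a₃
    Sub = SubP a₁ a₂ a₃

    v u : ℤ × ℤ × ℤ
    v = + 1 , v₂ , v₃
    u = -[1+ 0 ] , v₂ , v₃

    σᵛ : SignVector v
    σᵛ = +1ˢ , σ₂ , σ₃
    σᵘ : SignVector u
    σᵘ = -1ˢ , σ₂ , σ₃

    module V = Promotion {a₁} {a₂} {a₃} v σᵛ
    module U = Promotion {a₁} {a₂} {a₃} u σᵘ

    layer : E → ℕ
    layer x = toℕ (proj₁ x)

  ⟨⟩-flip₁ : (x : E) → ⟨ x , u ⟩ ≡ ⟨ x , v ⟩ ℤ.- + 2 ℤ.* coord₁ x
  ⟨⟩-flip₁ x = flip (coord₁ x) (coord₂ x) (coord₃ x) v₂ v₃
    where
    flip : ∀ c₁ c₂ c₃ w₂ w₃ → c₁ ℤ.* -[1+ 0 ] ℤ.+ c₂ ℤ.* w₂ ℤ.+ c₃ ℤ.* w₃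
                             ≡ (c₁ ℤ.* + 1 ℤ.+ c₂ ℤ.* w₂ ℤ.+ c₃ ℤ.* w₃) ℤ.- + 2 ℤ.* c₁
    flip = solve-∀

  within-layer-⟨⟩-< : ∀ (x y : E) → proj₁ x ≡ proj₁ y → ⟨ x , v ⟩ ℤ.< ⟨ y , v ⟩ → ⟨ x , u ⟩ ℤ.< ⟨ y , u ⟩
  within-layer-⟨⟩-< x y refl x<y = begin-strict
    ⟨ x , u ⟩                  ≡⟨ ⟨⟩-flip₁ x ⟩
    ⟨ x , v ⟩ ℤ.- + 2 ℤ.* c₁   <⟨ ℤ.+-monoˡ-< (ℤ.- (+ 2 ℤ.* c₁)) x<y ⟩
    ⟨ y , v ⟩ ℤ.- + 2 ℤ.* c₁   ≡⟨ ⟨⟩-flip₁ y ⟨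
    ⟨ y , u ⟩                  ∎
    where
    open ℤ.≤-Reasoning
    c₁ = coord₁ x

  iter-Pro-isOrderIdeal : ∀ n {S : Sub} → IsOrderIdeal S → IsOrderIdeal (iter n (Pro v) S)
  iter-Pro-isOrderIdeal zero    ideal = ideal
  iter-Pro-isOrderIdeal (suc n) ideal = V.Pro-isOrderIdeal (iter-Pro-isOrderIdeal n ideal)

  -- Since v-ranks increase along the first coordinate, each application of Pro_v lifts membership by at most
  -- one layer.
  iter-Pro-below : ∀ d {S : Sub} → IsOrderIdeal S → ∀ {x y : E} → x ≤P y → layer y ≡ d ℕ.+ layer x →
                   iter d (Pro v) S y ≡ true → S x ≡ true
  iter-Pro-below zero    ideal x≤y _ y∈ = ideal _ _ x≤y y∈
  iter-Pro-below (suc d) ideal {i , _ , _} {i′ , j′ , k′} (_ , q , r) i′≡ y∈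
    with <⇒pred-between {i = i} {i′} (ℕ.≤-trans (ℕ.s≤s (ℕ.m≤n+m _ d)) (ℕ.≤-reflexive (sym i′≡)))
  ... | f , i′≡suc-f , i≤f =
    iter-Pro-below d ideal (i≤f , q , r) (ℕ.suc-injective (trans (sym i′≡suc-f) i′≡))
      (V.Pro-below (iter-Pro-isOrderIdeal d ideal) f⋖y (⟨⟩-⋖-up {w = v} f⋖y refl) y∈)
    where
    f⋖y : (f , j′ , k′) ⋖ (i′ , j′ , k′)
    f⋖y = ⋖₁ i′≡suc-f

  module _ (I : Sub) (ideal : IsOrderIdeal I) where
    private
      J : ℕ → Sub
      J n = iter n (Pro v) I

      D : Sub
      D = Δ₁ v I

    Δ₁-isOrderIdeal : IsOrderIdeal D
    Δ₁-isOrderIdeal x y x≤y@(p , _ , _) y∈ =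
      trans (Δ₁-layer v I x) (iter-Pro-below d (iter-Pro-isOrderIdeal (layer x) ideal) x≤y layer-y≡
        (begin
          iter d (Pro v) (J (layer x)) y  ≡⟨ cong (λ S → S y) (iter-+ d (layer x) (Pro v) I) ⟨
          J (d ℕ.+ layer x) y             ≡⟨ cong (λ n → J n y) layer-y≡ ⟨
          J (layer y) y                   ≡⟨ Δ₁-layer v I y ⟨
          D y                             ≡⟨ y∈ ⟩
          true                            ∎))
      where
      open ≡-Reasoning
      d = layer y ∸ layer x
      layer-y≡ : layer y ≡ d ℕ.+ layer x
      layer-y≡ = sym (ℕ.m∸n+n≡m p)

    Pro-Δ₁-layer : ∀ x → Acc ℕ._<_ (depth σᵘ x) → Pro u D x ≡ J (suc (layer x)) x
    Pro-Δ₁-layer x@(i , j , k) (acc smaller) = begin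
      Pro u D x                   ≡⟨ Mᵘ.toggled ⟩
      toggle x Mᵘ.stage x         ≡⟨ toggle-local Mᵘ.stage-ideal Mᵛ.stage-ideal stage-at neighbours ⟩
      toggle x Mᵛ.stage x         ≡⟨ Mᵛ.toggled ⟨
      Pro v (J (layer x)) x       ∎
      where
      open ≡-Reasoning
      module Mᵘ = U.ToggledFrom (U.Pro-toggledFrom Δ₁-isOrderIdeal x)
      module Mᵛ = V.ToggledFrom (V.Pro-toggledFrom (iter-Pro-isOrderIdeal (layer x) ideal) x)

      IH : ∀ y → U.rank x ℤ.< U.rank y → Pro u D y ≡ J (suc (layer y)) y
      IH y x<y = Pro-Δ₁-layer y (smaller (depth-anti σᵘ x<y))

      stage-at : Mᵘ.stage x ≡ Mᵛ.stage x
      stage-at = trans Mᵘ.stage-at (trans (Δ₁-layer v I x) (sym Mᵛ.stage-at))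

      same-layer : ∀ y → proj₁ x ≡ proj₁ y → Adjacent x y →
                   Tri (V.rank x ℤ.< V.rank y) (V.rank x ≡ V.rank y) (V.rank y ℤ.< V.rank x) →
                   Mᵘ.stage y ≡ Mᵛ.stage y
      same-layer y refl x~y (tri< x<y _ _) = begin
        Mᵘ.stage y           ≡⟨ Mᵘ.stage-above y x~y (within-layer-⟨⟩-< x y refl x<y) ⟩
        Pro u D y            ≡⟨ IH y (within-layer-⟨⟩-< x y refl x<y) ⟩
        J (suc (layer x)) y  ≡⟨ Mᵛ.stage-above y x~y x<y ⟨
        Mᵛ.stage y           ∎
      same-layer y refl x~y (tri≈ _ x≡y _) = contradiction x≡y (⟨⟩-adjacent-≢ σᵛ x~y)
      same-layer y refl x~y (tri> _ _ y<x) = begin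
        Mᵘ.stage y           ≡⟨ Mᵘ.stage-below y x~y (within-layer-⟨⟩-< y x refl y<x) ⟩
        D y                  ≡⟨ Δ₁-layer v I y ⟩
        J (layer x) y        ≡⟨ Mᵛ.stage-below y x~y y<x ⟨
        Mᵛ.stage y           ∎

      neighbours : ∀ y → Adjacent x y → Mᵘ.stage y ≡ Mᵛ.stage y
      neighbours y x~y@(inj₁ x⋖y@(⋖₁ i′≡)) = begin
        Mᵘ.stage y           ≡⟨ Mᵘ.stage-below y x~y (⟨⟩-⋖-down {w = u} x⋖y refl) ⟩
        D y                  ≡⟨ Δ₁-layer v I y ⟩
        J (layer y) y        ≡⟨ cong (λ n → J n y) i′≡ ⟩
        J (suc (layer x)) y  ≡⟨ Mᵛ.stage-above y x~y (⟨⟩-⋖-up {w = v} x⋖y refl) ⟨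
        Mᵛ.stage y           ∎
      neighbours y x~y@(inj₂ y⋖x@(⋖₁ i≡)) = begin
        Mᵘ.stage y           ≡⟨ Mᵘ.stage-above y x~y (⟨⟩-⋖-down {w = u} y⋖x refl) ⟩
        Pro u D y            ≡⟨ IH y (⟨⟩-⋖-down {w = u} y⋖x refl) ⟩
        J (suc (layer y)) y  ≡⟨ cong (λ n → J n y) i≡ ⟨
        J (layer x) y        ≡⟨ Mᵛ.stage-below y x~y (⟨⟩-⋖-up {w = v} y⋖x refl) ⟨
        Mᵛ.stage y           ∎
      neighbours _ x~y@(inj₁ (⋖₂ _)) = same-layer _ refl x~y (ℤ.<-cmp _ _)
      neighbours _ x~y@(inj₁ (⋖₃ _)) = same-layer _ refl x~y (ℤ.<-cmp _ _)
      neighbours _ x~y@(inj₂ (⋖₂ _)) = same-layer _ refl x~y (ℤ.<-cmp _ _)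
      neighbours _ x~y@(inj₂ (⋖₃ _)) = same-layer _ refl x~y (ℤ.<-cmp _ _)

    Pro-Δ₁ : ∀ x → Pro u (Δ₁ v I) x ≡ Δ₁ v (Pro v I) x
    Pro-Δ₁ x = begin
      Pro u D x                          ≡⟨ Pro-Δ₁-layer x (ℕ.<-wellFounded (depth σᵘ x)) ⟩
      J (suc (layer x)) x                ≡⟨ cong (λ S → S x) (iter-suc (layer x) (Pro v) I) ⟨
      iter (layer x) (Pro v) (Pro v I) x ≡⟨ Δ₁-layer v (Pro v I) x ⟨
      Δ₁ v (Pro v I) x                   ∎
      where open ≡-Reasoning

corollary4p8 : (a₁ a₂ a₃ : ℕ) (I : SubP a₁ a₂ a₃) → IsOrderIdeal I →
    ∀ x → Pro (-[1+ 0 ] , + 1 , -[1+ 0 ]) (Δ₁ (+ 1 , + 1 , -[1+ 0 ]) I) x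
        ≡ Δ₁ (+ 1 , + 1 , -[1+ 0 ]) (Pro (+ 1 , + 1 , -[1+ 0 ]) I) x
corollary4p8 _ _ _ = Pro-Δ₁ +1ˢ -1ˢ
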